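{- Every 4-connected $\{Z_1,K_{1,4}\}$-free graph $G$ with $|V(G)|\ge 9$ contains an $H^2$.
   Context: All graphs are finite and simple. $K_{1,4}$ is the star with 4 leaves. $Z_1$ is the graph obtained from $K_{1,3}$ by adding one edge between two of its leaves. A graph is $\{Z_1,K_{1,4}\}$-free if it has no induced subgraph isomorphic to $Z_1$ or $K_{1,4}$. The square of a graph is obtained by adding edges joining all pairs of vertices at distance two. A graph $G$ contains an $H^2$ if $G$ contains, as a subgraph, the square of some hamiltonian cycle of $G$. -}

module Defs where

open import Data.Nat using (ℕ; zero; suc; _+_; _<_; _≤_)
open import Data.Fin using (Fin; toℕ)
open import Data.Fin.Subset using (Subset; _∈_; _∉_; ∣_∣)
open import Data.Fin.Permutation using (Permutation′; _⟨$⟩ʳ_)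
open import Data.Bool using (Bool; true; false)
open import Data.Product using (Σ; ∃; _×_; _,_)
open import Data.Sum using (_⊎_)
open import Relation.Binary.PropositionalEquality using (_≡_)
open import Relation.Nullary using (¬_)
open import Function.Definitions using (Injective)

record Graph (n : ℕ) : Set where
  field
    adj    : Fin n → Fin n → Bool
    sym    : ∀ u v → adj u v ≡ adj v u
    irrefl : ∀ v → adj v v ≡ false
open Graph public

record InducedCopy {k n : ℕ} (H : Graph k) (G : Graph n) : Set where
  field
    f      : Fin k → Fin n
    inj    : Injective _≡_ _≡_ f
    preserve : ∀ i j → adj G (f i) (f j) ≡ adj H i j

-- Helper for small graphs: adjacency by toℕ of endpoints.
-- Z₁: vertex 0 is the centre of K_{1,3} with leaves 1,2,3; extra edge 1–2.
Z₁-adjℕ : ℕ → ℕ → Bool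
Z₁-adjℕ 0 1 = true
Z₁-adjℕ 0 2 = true
Z₁-adjℕ 0 3 = true
Z₁-adjℕ 1 0 = true
Z₁-adjℕ 2 0 = true
Z₁-adjℕ 3 0 = true
Z₁-adjℕ 1 2 = true
Z₁-adjℕ 2 1 = true
Z₁-adjℕ _ _ = false

Z₁ : Graph 4
Z₁ = record { adj = λ u v → Z₁-adjℕ (toℕ u) (toℕ v) ; sym = s ; irrefl = r }
  where
  open import Data.Fin using (zero; suc)
  open import Relation.Binary.PropositionalEquality using (refl)
  s : ∀ u v → Z₁-adjℕ (toℕ u) (toℕ v) ≡ Z₁-adjℕ (toℕ v) (toℕ u)
  s zero zero = refl
  s zero (suc zero) = refl
  s zero (suc (suc zero)) = refl
  s zero (suc (suc (suc zero))) = refl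
  s (suc zero) zero = refl
  s (suc zero) (suc zero) = refl
  s (suc zero) (suc (suc zero)) = refl
  s (suc zero) (suc (suc (suc zero))) = refl
  s (suc (suc zero)) zero = refl
  s (suc (suc zero)) (suc zero) = refl
  s (suc (suc zero)) (suc (suc zero)) = refl
  s (suc (suc zero)) (suc (suc (suc zero))) = refl
  s (suc (suc (suc zero))) zero = refl
  s (suc (suc (suc zero))) (suc zero) = refl
  s (suc (suc (suc zero))) (suc (suc zero)) = refl
  s (suc (suc (suc zero))) (suc (suc (suc zero))) = refl
  r : ∀ v → Z₁-adjℕ (toℕ v) (toℕ v) ≡ false
  r zero = refl
  r (suc zero) = refl
  r (suc (suc zero)) = refl
  r (suc (suc (suc zero))) = refl

K₁₄-adjℕ : ℕ → ℕ → Bool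
K₁₄-adjℕ 0 0 = false
K₁₄-adjℕ 0 _ = true
K₁₄-adjℕ _ 0 = true
K₁₄-adjℕ _ _ = false

K₁₄ : Graph 5
K₁₄ = record { adj = λ u v → K₁₄-adjℕ (toℕ u) (toℕ v) ; sym = s ; irrefl = r }
  where
  open import Data.Fin using (zero; suc)
  open import Relation.Binary.PropositionalEquality using (refl)
  s : ∀ u v → K₁₄-adjℕ (toℕ u) (toℕ v) ≡ K₁₄-adjℕ (toℕ v) (toℕ u)
  s zero zero = refl
  s zero (suc v) = refl
  s (suc u) zero = refl
  s (suc u) (suc v) = refl
  r : ∀ v → K₁₄-adjℕ (toℕ v) (toℕ v) ≡ false
  r zero = refl
  r (suc v) = refl

Free : ∀ {k n} → Graph k → Graph n → Set
Free H G = ¬ InducedCopy H G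

data ReachAvoiding {n : ℕ} (G : Graph n) (S : Subset n) : Fin n → Fin n → Set where
  here : ∀ {u} → u ∉ S → ReachAvoiding G S u u
  step : ∀ {u v w} → u ∉ S → adj G u v ≡ true → ReachAvoiding G S v w →
         ReachAvoiding G S u w

ConnectedAvoiding : ∀ {n} → Graph n → Subset n → Set
ConnectedAvoiding {n} G S = ∀ (u v : Fin n) → u ∉ S → v ∉ S → ReachAvoiding G S u v

KConnected : ℕ → ∀ {n} → Graph n → Set
KConnected k {n} G = (k < n) × (∀ (S : Subset n) → ∣ S ∣ < k → ConnectedAvoiding G S)

-- G contains the square of a hamiltonian cycle: a cyclic ordering σ of all
-- vertices (a permutation of Fin n) such that σ(i) is adjacent to σ(i+1 mod n)
-- and to σ(i+2 mod n).  "j ≡ i + d (mod n)" with i,j < n, d ∈ {1,2} is written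
-- toℕ i + d ≡ toℕ j  or  toℕ i + d ≡ toℕ j + n.
CyclicStep : ∀ {n} → ℕ → Fin n → Fin n → Set
CyclicStep {n} d i j = (toℕ i + d ≡ toℕ j) ⊎ (toℕ i + d ≡ toℕ j + n)

ContainsH² : ∀ {n} → Graph n → Set
ContainsH² {n} G =
  Σ (Permutation′ n) λ σ →
    ∀ (i j : Fin n) → (CyclicStep 1 i j ⊎ CyclicStep 2 i j) →
      adj G (σ ⟨$⟩ʳ i) (σ ⟨$⟩ʳ j) ≡ true

module Submission where

-- Write u ≁ v when u and v are not adjacent (in particular v ≁ v).
-- (1) Structure.  4-connectivity gives minimum degree 4 and connectedness.
--     Z₁- and K₁₄-freeness then yield a common neighbour of u, x, w whenever
--     u ~ x, u ~ w and x ≁ w; with it, the vertices seeing neither end of an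
--     edge are closed under adjacency, hence there are none, so ≁ is
--     transitive: G is complete multipartite.  A part with four vertices and
--     a neighbour of it would be an induced K₁₄, so parts have ≤ 3 vertices.
-- (2) Construction.  In a complete multipartite graph with parts of size ≤ 3
--     and n ≥ 9 vertices, rank the vertices so that parts are consecutive and
--     the 3-element parts come first; two vertices of one part then have ranks
--     r, r+1, or r, r+2 with 3 ∣ r.  Reading the ranks column by column as a
--     3-row array puts all such pairs at cyclic distance ≥ 3, so vertices one
--     or two steps apart in the resulting cyclic order are adjacent.

open import Defs hiding (sym)
open import Data.Nat using (ℕ; zero; suc; _+_; _*_; _∸_; _≤_; _<_; z≤n; s≤s; _≟_; _≤?_; _<?_)
open import Data.Nat.Properties hiding (_≟_)
open import Data.Nat.DivMod
  using (_/_; _%_; m≡m%n+[m/n]*n; m%n<n; [m+kn]%n≡m%n; m<n⇒m%n≡m; +-distrib-/-∣ʳ;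
         m<n⇒m/n≡0; m*n/n≡m; /-monoˡ-≤; m/n≡1+[m∸n]/n)
open import Data.Nat.Divisibility using (_∣_; divides-refl; ∣m∣n⇒∣m+n; ∣-refl)
open import Data.Fin using (Fin; zero; suc; toℕ; fromℕ<; punchOut)
open import Data.Fin.Properties
  using (toℕ-injective; toℕ<n; toℕ-fromℕ<; any?; injective⇒≤; punchOut-injective)
  renaming (_≟_ to _≟ᶠ_)
open import Data.Fin.Subset using (Subset; _∈_; _∉_; ∣_∣) renaming (⊥ to ∅)
open import Data.Fin.Subset.Properties using () renaming (∉⊥ to ∉∅; ∣⊥∣≡0 to ∣∅∣≡0)
open import Data.Fin.Permutation using (Permutation′; permutation; _⟨$⟩ʳ_)
open import Data.Bool using (Bool; true; false; _∧_; _∨_; not; if_then_else_)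
open import Data.Bool.Properties using (∧-zeroʳ)
import Data.Bool.Properties as Bool
open import Data.Vec using (tabulate)
open import Data.Vec.Properties using (lookup⇒[]=; []=⇒lookup; lookup∘tabulate)
open import Data.Product using (Σ; ∃; _×_; _,_; proj₁; proj₂)
open import Data.Sum using (_⊎_; inj₁; inj₂)
open import Data.Empty using (⊥; ⊥-elim)
open import Function using (_∘_; case_of_)
open import Function.Definitions using (Injective)
open import Relation.Nullary using (¬_; Dec; does; yes; no)
open import Relation.Nullary.Decidable using (dec-true; dec-false; _×-dec_)
open import Relation.Binary.PropositionalEquality
open import Relation.Binary.Definitions using (tri<; tri≈; tri>)

does-sound : ∀ {A : Set} (d : Dec A) → does d ≡ true → A
does-sound (yes a) _ = a

_==_ : ∀ {n} → Fin n → Fin n → Bool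
x == y = does (x ≟ᶠ y)

==-refl : ∀ {n} (x : Fin n) → (x == x) ≡ true
==-refl x = dec-true (x ≟ᶠ x) refl

==-false : ∀ {n} {x y : Fin n} → x ≢ y → (x == y) ≡ false
==-false {x = x} {y} = dec-false (x ≟ᶠ y)

==-false⁻ : ∀ {n} {x y : Fin n} → (x == y) ≡ false → x ≢ y
==-false⁻ {x = x} e refl = case trans (sym (==-refl x)) e of λ ()

count : ∀ {n} → (Fin n → Bool) → ℕ
count {zero}  p = 0
count {suc n} p = (if p zero then 1 else 0) + count (p ∘ suc)

count-cong : ∀ {n} {p q : Fin n → Bool} → (∀ x → p x ≡ q x) → count p ≡ count q
count-cong {zero}  e = refl
count-cong {suc n} {p} {q} e =
  cong₂ (λ b c → (if b then 1 else 0) + c) (e zero) (count-cong (e ∘ suc))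

count-mono : ∀ {n} {p q : Fin n → Bool} → (∀ x → p x ≡ true → q x ≡ true) →
             count p ≤ count q
count-mono {zero} h = z≤n
count-mono {suc n} {p} {q} h with p zero in p₀ | q zero in q₀
... | false | false = count-mono (h ∘ suc)
... | false | true  = m≤n⇒m≤1+n (count-mono (h ∘ suc))
... | true  | true  = s≤s (count-mono (h ∘ suc))
... | true  | false with () ← trans (sym (h zero p₀)) q₀

count-mono-< : ∀ {n} {p q : Fin n → Bool} → (∀ x → p x ≡ true → q x ≡ true) →
               ∀ y → p y ≡ false → q y ≡ true → count p < count q
count-mono-< {suc n} {p} {q} h zero pʸ qʸ rewrite pʸ | qʸ = s≤s (count-mono (h ∘ suc))
count-mono-< {suc n} {p} {q} h (suc y) pʸ qʸ with p zero in p₀ | q zero in q₀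
... | false | false = count-mono-< (h ∘ suc) y pʸ qʸ
... | false | true  = m≤n⇒m≤1+n (count-mono-< (h ∘ suc) y pʸ qʸ)
... | true  | true  = s≤s (count-mono-< (h ∘ suc) y pʸ qʸ)
... | true  | false with () ← trans (sym (h zero p₀)) q₀

count-true : ∀ {n} → count {n} (λ _ → true) ≡ n
count-true {zero}  = refl
count-true {suc n} = cong suc (count-true {n})

count-false : ∀ {n} → count {n} (λ _ → false) ≡ 0
count-false {zero}  = refl
count-false {suc n} = count-false {n}

count≤n : ∀ {n} (p : Fin n → Bool) → count p ≤ n
count≤n {n} p = subst (count p ≤_) (count-true {n}) (count-mono {n} {p} {λ _ → true} (λ _ _ → refl))

count<n : ∀ {n} {p : Fin n → Bool} y → p y ≡ false → count p < n
count<n {n} {p} y pʸ = subst (count p <_) (count-true {n}) (count-mono-< {n} {p} {λ _ → true} (λ _ _ → refl) y pʸ refl)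

count-∨ : ∀ {n} (p q : Fin n → Bool) → count (λ x → p x ∨ q x) ≤ count p + count q
count-∨ {zero}  p q = z≤n
count-∨ {suc n} p q with p zero | q zero
... | false | false = count-∨ (p ∘ suc) (q ∘ suc)
... | false | true  = ≤-trans (s≤s (count-∨ (p ∘ suc) (q ∘ suc))) (≤-reflexive (sym (+-suc _ _)))
... | true  | false = s≤s (count-∨ (p ∘ suc) (q ∘ suc))
... | true  | true  = s≤s (≤-trans (count-∨ (p ∘ suc) (q ∘ suc)) (+-monoʳ-≤ _ (n≤1+n _)))

count-split : ∀ {n} (p q : Fin n → Bool) →
              count p ≡ count (λ x → p x ∧ q x) + count (λ x → p x ∧ not (q x))
count-split {zero}  p q = refl
count-split {suc n} p q with p zero | q zero
... | false | _     = count-split (p ∘ suc) (q ∘ suc)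
... | true  | true  = cong suc (count-split (p ∘ suc) (q ∘ suc))
... | true  | false = trans (cong suc (count-split (p ∘ suc) (q ∘ suc))) (sym (+-suc _ _))

count-single : ∀ {n} (x : Fin n) → count (_== x) ≡ 1
count-single {suc n} zero    = cong suc (count-false {n})
count-single {suc n} (suc x) = count-single x

witness : ∀ {n} (p : Fin n → Bool) → 0 < count p → ∃ λ y → p y ≡ true
witness {suc n} p c with p zero in p₀
... | true  = zero , p₀
... | false with y , pʸ ← witness (p ∘ suc) c = suc y , pʸ

counter-witness : ∀ {n} (p : Fin n → Bool) → count p < n → ∃ λ y → p y ≡ false
counter-witness {suc n} p c with p zero in p₀
... | false = zero , p₀
... | true with y , pʸ ← counter-witness (p ∘ suc) (≤-pred c) = suc y , pʸ

infixl 20 _∖_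
_∖_ : ∀ {n} → (Fin n → Bool) → Fin n → Fin n → Bool
(p ∖ x) y = p y ∧ not (y == x)

count-remove : ∀ {n} (p : Fin n → Bool) x → count p ≤ suc (count (p ∖ x))
count-remove p x = begin
  count p                                        ≡⟨ count-split p (_== x) ⟩
  count (λ y → p y ∧ y == x) + count (p ∖ x)     ≤⟨ +-monoˡ-≤ _ at-most-x ⟩
  count (_== x) + count (p ∖ x)                  ≡⟨ cong (_+ count (p ∖ x)) (count-single x) ⟩
  suc (count (p ∖ x))                            ∎
  where
  open ≤-Reasoning
  at-most-x : count (λ y → p y ∧ y == x) ≤ count (_== x)
  at-most-x = count-mono λ y → Bool.∧-conicalʳ (p y) _

pick : ∀ {n} (q : Fin n → Bool) k → suc k ≤ count q →
       ∃ λ x → q x ≡ true × k ≤ count (q ∖ x)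
pick q k c with x , qˣ ← witness q (≤-trans (s≤s z≤n) c) =
  x , qˣ , ≤-pred (≤-trans c (count-remove q x))

drop : ∀ {n} (q : Fin n → Bool) x y → (q ∖ x) y ≡ true → q y ≡ true × y ≢ x
drop q x y e with q y | y ≟ᶠ x
... | true | no y≢x = refl , y≢x

count-∖ : ∀ {n} {p : Fin n → Bool} x → p x ≡ true → count (p ∖ x) < count p
count-∖ {p = p} x pˣ = count-mono-< (λ y e → proj₁ (drop p x y e)) x x-removed pˣ
  where
  x-removed : (p ∖ x) x ≡ false
  x-removed rewrite ==-refl x = ∧-zeroʳ (p x)

distinct : ∀ {n} (p : Fin n → Bool) k → k ≤ count p →
           Σ (Fin k → Fin n) λ f → Injective _≡_ _≡_ f × (∀ i → p (f i) ≡ true)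
distinct p zero    _ = (λ ()) , (λ { {()} }) , λ ()
distinct p (suc k) c with pick p k c
... | x , pˣ , c′ with distinct (p ∖ x) k c′
... | f , f-injective , pᶠ = g , g-injective , pᵍ
  where
  g : Fin (suc k) → Fin _
  g zero    = x
  g (suc i) = f i
  f≢x : ∀ i → f i ≢ x
  f≢x i = proj₂ (drop p x (f i) (pᶠ i))
  g-injective : Injective _≡_ _≡_ g
  g-injective {zero}  {zero}  _ = refl
  g-injective {zero}  {suc j} e = ⊥-elim (f≢x j (sym e))
  g-injective {suc i} {zero}  e = ⊥-elim (f≢x i e)
  g-injective {suc i} {suc j} e = cong suc (f-injective e)
  pᵍ : ∀ i → p (g i) ≡ true
  pᵍ zero    = pˣ
  pᵍ (suc i) = proj₁ (drop p x (f i) (pᶠ i))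

-- The least index satisfying p (n if there is none).
least : ∀ {n} → (Fin n → Bool) → ℕ
least {zero}  p = 0
least {suc n} p = if p zero then 0 else suc (least (p ∘ suc))

least-≤ : ∀ {n} {p : Fin n → Bool} x → p x ≡ true → least p ≤ toℕ x
least-≤ {suc n} {p} zero pˣ rewrite pˣ = z≤n
least-≤ {suc n} {p} (suc x) pˣ with p zero
... | true  = z≤n
... | false = s≤s (least-≤ x pˣ)

least-attained : ∀ {n} {p : Fin n → Bool} x → p x ≡ true →
                 ∃ λ y → p y ≡ true × least p ≡ toℕ y
least-attained {suc n} {p} x pˣ with p zero in p₀
least-attained {suc n} {p} x       pˣ | true  = zero , p₀ , refl
least-attained {suc n} {p} zero    pˣ | false with () ← trans (sym pˣ) p₀
least-attained {suc n} {p} (suc x) pˣ | false with y , pʸ , e ← least-attained x pˣ =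
  suc y , pʸ , cong suc e

least-cong : ∀ {n} {p q : Fin n → Bool} → (∀ x → p x ≡ q x) → least p ≡ least q
least-cong {zero}  e = refl
least-cong {suc n} {p} {q} e rewrite e zero with q zero
... | true  = refl
... | false = cong suc (least-cong (e ∘ suc))

lex-< : ∀ {a a′ x y N} → a < a′ → x < N → x + a * N < y + a′ * N
lex-< {a} {a′} {x} {y} {N} a<a′ x<N = begin-strict
  x + a * N  <⟨ +-monoˡ-< (a * N) x<N ⟩
  N + a * N  ≤⟨ *-monoˡ-≤ N a<a′ ⟩
  a′ * N     ≤⟨ m≤n+m (a′ * N) y ⟩
  y + a′ * N ∎
  where open ≤-Reasoning

lex-≤ : ∀ {a a′ x y N} → x + a * N ≤ y + a′ * N → y < N → a ≤ a′
lex-≤ {a} {a′} le y<N with a ≤? a′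
... | yes a≤a′ = a≤a′
... | no  a≰a′ = ⊥-elim (<⇒≱ (lex-< (≰⇒> a≰a′) y<N) le)

lex-≡ : ∀ {a a′ x y N} → x + a * N ≡ y + a′ * N → x < N → y < N → a ≡ a′ × x ≡ y
lex-≡ {a} {a′} {x} {y} {N} e x<N y<N =
  a≡a′ , +-cancelʳ-≡ (a * N) x y (trans e (cong (λ b → y + b * N) (sym a≡a′)))
  where
  a≡a′ : a ≡ a′
  a≡a′ = ≤-antisym (lex-≤ (≤-reflexive e) y<N) (lex-≤ (≤-reflexive (sym e)) x<N)

squeeze : ∀ {a b c k} → a ≤ b → b < c → c < a + k → k ≤ 3 → c ≢ suc b →
          b ≡ a × c ≡ 2 + b × k ≡ 3
squeeze {a} {b} {c} {k} a≤b b<c c<a+k k≤3 c≢1+b = b≡a , c≡2+b , k≡3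
  where
  2+b≤c : 2 + b ≤ c
  2+b≤c with m≤n⇒m<n∨m≡n b<c
  ... | inj₁ 1+b<c  = 1+b<c
  ... | inj₂ 1+b≡c = ⊥-elim (c≢1+b (sym 1+b≡c))
  c<a+3 : c < a + 3
  c<a+3 = <-≤-trans c<a+k (+-monoʳ-≤ a k≤3)
  b≡a : b ≡ a
  b≡a = ≤-antisym (+-cancelˡ-≤ 2 b a (≤-pred (≤-trans (s≤s 2+b≤c) (≤-trans c<a+3 (≤-reflexive (+-comm a 3)))))) a≤b
  c≡2+b : c ≡ 2 + b
  c≡2+b = ≤-antisym (≤-pred (≤-trans c<a+3 (≤-reflexive (trans (+-comm a 3) (cong (3 +_) (sym b≡a)))))) 2+b≤c
  k≡3 : k ≡ 3
  k≡3 = ≤-antisym k≤3 (+-cancelˡ-≤ a 3 k (≤-trans (≤-reflexive (+-comm a 3))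
          (subst (λ z → suc z ≤ a + k) (trans c≡2+b (cong (2 +_) b≡a)) c<a+k)))

thirds : ∀ m → (m + 2) / 3 + (m + 1) / 3 + m / 3 ≡ m
thirds 0 = refl
thirds 1 = refl
thirds 2 = refl
thirds (suc (suc (suc m))) = begin
  (3 + (m + 2)) / 3 + (3 + (m + 1)) / 3 + (3 + m) / 3
    ≡⟨ cong₃ (λ a b c → a + b + c) (+3 (m + 2)) (+3 (m + 1)) (+3 m) ⟩
  suc ((m + 2) / 3) + suc ((m + 1) / 3) + suc (m / 3)
    ≡⟨ cong (_+ suc (m / 3)) (cong suc (+-suc ((m + 2) / 3) ((m + 1) / 3))) ⟩
  suc (suc ((m + 2) / 3 + (m + 1) / 3)) + suc (m / 3)
    ≡⟨ cong (λ k → suc (suc k)) (+-suc ((m + 2) / 3 + (m + 1) / 3) (m / 3)) ⟩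
  3 + ((m + 2) / 3 + (m + 1) / 3 + m / 3)
    ≡⟨ cong (3 +_) (thirds m) ⟩
  3 + m ∎
  where
  open ≡-Reasoning
  +3 : ∀ k → (3 + k) / 3 ≡ suc (k / 3)
  +3 k = m/n≡1+[m∸n]/n {3 + k} {3} (s≤s (s≤s (s≤s z≤n)))
  cong₃ : ∀ {a b c a′ b′ c′ : ℕ} (f : ℕ → ℕ → ℕ → ℕ) → a ≡ a′ → b ≡ b′ → c ≡ c′ →
          f a b c ≡ f a′ b′ c′
  cong₃ f refl refl refl = refl

data Digits : ℕ → Set where
  digits : ∀ q c → c < 3 → Digits (c + q * 3)

toDigits : ∀ r → Digits r
toDigits r = subst Digits (sym (m≡m%n+[m/n]*n r 3)) (digits (r / 3) (r % 3) (m%n<n r 3))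

digit-% : ∀ q c → c < 3 → (c + q * 3) % 3 ≡ c
digit-% q c c<3 = trans ([m+kn]%n≡m%n c q 3) (m<n⇒m%n≡m c<3)

digit-/ : ∀ q c → c < 3 → (c + q * 3) / 3 ≡ q
digit-/ q c c<3 = begin
  (c + q * 3) / 3     ≡⟨ +-distrib-/-∣ʳ c (divides-refl q) ⟩
  c / 3 + q * 3 / 3   ≡⟨ cong₂ _+_ (m<n⇒m/n≡0 c<3) (m*n/n≡m q 3) ⟩
  q                   ∎
  where open ≡-Reasoning

≤-/3 : ∀ k m → k * 3 ≤ m → k ≤ m / 3
≤-/3 k m le = subst (_≤ m / 3) (m*n/n≡m k 3) (/-monoˡ-≤ 3 le)

module Cycle (n : ℕ) where

  Step : ℕ → ℕ → ℕ → Set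
  Step d a b = (a + d ≡ b) ⊎ (a + d ≡ b + n)

  step-irrefl : ∀ {a d} → 0 < d → d < n → ¬ Step d a a
  step-irrefl {a} {d} 0<d _ (inj₁ a+d≡a) =
    <⇒≢ 0<d (sym (+-cancelˡ-≡ a d 0 (trans a+d≡a (sym (+-identityʳ a)))))
  step-irrefl {a} {d} _ d<n (inj₂ a+d≡a+n) = <⇒≢ d<n (+-cancelˡ-≡ a d n a+d≡a+n)

  Far : ℕ → ℕ → Set
  Far a b = ∃ λ D → 3 ≤ D × D + 3 ≤ n × ((a + D ≡ b) ⊎ (b + D ≡ a))

  Far-sym : ∀ {a b} → Far a b → Far b a
  Far-sym (D , 3≤D , D+3≤n , inj₁ e) = D , 3≤D , D+3≤n , inj₂ e
  Far-sym (D , 3≤D , D+3≤n , inj₂ e) = D , 3≤D , D+3≤n , inj₁ e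

  far⇒¬step : ∀ {a b d} → Far a b → d ≤ 2 → ¬ Step d a b
  far⇒¬step {a} {b} {d} (D , 3≤D , _ , inj₁ a+D≡b) d≤2 (inj₁ a+d≡b) =
    <⇒≱ (s≤s d≤2) (≤-trans 3≤D (≤-reflexive (+-cancelˡ-≡ a D d (trans a+D≡b (sym a+d≡b)))))
  far⇒¬step {a} {b} {d} (D , 3≤D , _ , inj₁ a+D≡b) d≤2 (inj₂ a+d≡b+n) =
    <⇒≱ (s≤s d≤2) (≤-trans (≤-trans 3≤D (m≤m+n D n)) (≤-reflexive (sym d≡D+n)))
    where
    d≡D+n : d ≡ D + n
    d≡D+n = +-cancelˡ-≡ a d (D + n)
              (trans a+d≡b+n (trans (cong (_+ n) (sym a+D≡b)) (+-assoc a D n)))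
  far⇒¬step {a} {b} {d} (D , 3≤D , _ , inj₂ b+D≡a) d≤2 (inj₁ a+d≡b) =
    <⇒≱ (≤-trans (s≤s z≤n) (≤-trans 3≤D (m≤m+n D d))) (≤-reflexive D+d≡0)
    where
    D+d≡0 : D + d ≡ 0
    D+d≡0 = +-cancelˡ-≡ b (D + d) 0
              (trans (sym (+-assoc b D d)) (trans (cong (_+ d) b+D≡a) (trans a+d≡b (sym (+-identityʳ b)))))
  far⇒¬step {a} {b} {d} (D , _ , D+3≤n , inj₂ b+D≡a) d≤2 (inj₂ a+d≡b+n) =
    <⇒≱ (s≤s d≤2) (+-cancelˡ-≤ D 3 d (≤-trans D+3≤n (≤-reflexive (sym D+d≡n))))
    where
    D+d≡n : D + d ≡ n
    D+d≡n = +-cancelˡ-≡ b (D + d) n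
              (trans (sym (+-assoc b D d)) (trans (cong (_+ d) b+D≡a) a+d≡b+n))

-- Reading 0 … n-1 as a three-row array column by column: position c + 3q
-- (c < 3) is sent to q + offset c, where the blocks of residues 0, 1, 2 have
-- heights (n+2)/3, (n+1)/3 and n/3.  For n ≥ 9 every block has height ≥ 3,
-- which makes all neighbours r, r+1 (and r, r+2 with 3 ∣ r) far apart.
module Layout (n : ℕ) (9≤n : 9 ≤ n) where
  open Cycle n

  height : ℕ → ℕ
  height 0 = (n + 2) / 3
  height 1 = (n + 1) / 3
  height _ = n / 3

  offset : ℕ → ℕ
  offset 0 = 0
  offset 1 = height 0
  offset _ = height 0 + height 1

  layout : ℕ → ℕ
  layout r = r / 3 + offset (r % 3)

  heights-sum : height 0 + height 1 + height 2 ≡ n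
  heights-sum = thirds n

  height≥3 : ∀ c → 3 ≤ height c
  height≥3 0 = /-monoˡ-≤ 3 (≤-trans 9≤n (m≤m+n n 2))
  height≥3 1 = /-monoˡ-≤ 3 (≤-trans 9≤n (m≤m+n n 1))
  height≥3 (suc (suc c)) = /-monoˡ-≤ 3 9≤n

  layout-digits : ∀ q c → c < 3 → layout (c + q * 3) ≡ q + offset c
  layout-digits q c c<3 = cong₂ (λ a b → a + offset b) (digit-/ q c c<3) (digit-% q c c<3)

  row<height : ∀ q c → c < 3 → c + q * 3 < n → q < height c
  row<height q 0 _ r<n =
    ≤-/3 (suc q) (n + 2) (subst (_≤ n + 2) (+-comm (1 + q * 3) 2) (+-monoˡ-≤ 2 r<n))
  row<height q 1 _ r<n =
    ≤-/3 (suc q) (n + 1) (subst (_≤ n + 1) (+-comm (2 + q * 3) 1) (+-monoˡ-≤ 1 r<n))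
  row<height q 2 _ r<n = ≤-/3 (suc q) n r<n
  row<height q (suc (suc (suc _))) (s≤s (s≤s (s≤s ()))) _

  block-end≤start : ∀ {c c′} → c < c′ → c′ < 3 → offset c + height c ≤ offset c′
  block-end≤start {0} {1} _ _ = ≤-refl
  block-end≤start {0} {2} _ _ = m≤m+n (height 0) (height 1)
  block-end≤start {1} {2} _ _ = ≤-refl
  block-end≤start {1} {1} (s≤s ()) _
  block-end≤start {suc (suc _)} {1} (s≤s ()) _
  block-end≤start {suc (suc _)} {2} (s≤s (s≤s ())) _
  block-end≤start {_} {suc (suc (suc _))} _ (s≤s (s≤s (s≤s ())))

  block-end≤n : ∀ c → c < 3 → offset c + height c ≤ n
  block-end≤n 0 _ = ≤-trans (m≤m+n (height 0) (height 1)) (≤-trans (m≤m+n _ (height 2)) (≤-reflexive heights-sum))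
  block-end≤n 1 _ = ≤-trans (m≤m+n _ (height 2)) (≤-reflexive heights-sum)
  block-end≤n 2 _ = ≤-reflexive heights-sum
  block-end≤n (suc (suc (suc _))) (s≤s (s≤s (s≤s ())))

  layout-in-block : ∀ q c → c < 3 → c + q * 3 < n →
                    offset c ≤ layout (c + q * 3) × layout (c + q * 3) < offset c + height c
  layout-in-block q c c<3 r<n rewrite layout-digits q c c<3 =
    m≤n+m (offset c) q ,
    subst (_< offset c + height c) (+-comm (offset c) q) (+-monoʳ-< (offset c) (row<height q c c<3 r<n))

  layout<n : ∀ {r} → r < n → layout r < n
  layout<n {r} r<n with toDigits r
  ... | digits q c c<3 = <-≤-trans (proj₂ (layout-in-block q c c<3 r<n)) (block-end≤n c c<3)

  block-order : ∀ q {c} → c < 3 → c + q * 3 < n → ∀ q′ {c′} → c′ < 3 → c′ + q′ * 3 < n → c < c′ →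
                layout (c + q * 3) < layout (c′ + q′ * 3)
  block-order q {c} c<3 r<n q′ {c′} c′<3 s<n c<c′ =
    <-≤-trans (proj₂ (layout-in-block q c c<3 r<n))
      (≤-trans (block-end≤start c<c′ c′<3) (proj₁ (layout-in-block q′ c′ c′<3 s<n)))

  layout-injective : ∀ {r s} → r < n → s < n → layout r ≡ layout s → r ≡ s
  layout-injective {r} {s} r<n s<n e with toDigits r | toDigits s
  ... | digits q c c<3 | digits q′ c′ c′<3 with <-cmp c c′
  ... | tri< c<c′ _ _ = ⊥-elim (<-irrefl e (block-order q c<3 r<n q′ c′<3 s<n c<c′))
  ... | tri> _ _ c′<c = ⊥-elim (<-irrefl (sym e) (block-order q′ c′<3 s<n q c<3 r<n c′<c))
  ... | tri≈ _ refl _ = cong (λ k → c + k * 3) (+-cancelʳ-≡ (offset c) q q′ same-row)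
    where
    same-row : q + offset c ≡ q′ + offset c
    same-row = trans (sym (layout-digits q c c<3)) (trans e (layout-digits q′ c c′<3))

  low : ℕ
  low = height 0 + height 1

  6≤low : 6 ≤ low
  6≤low = +-mono-≤ (height≥3 0) (height≥3 1)

  height₀+3≤n : height 0 + 3 ≤ n
  height₀+3≤n = begin
    height 0 + 3                     ≤⟨ +-monoʳ-≤ (height 0) (≤-trans (height≥3 1) (m≤m+n _ _)) ⟩
    height 0 + (height 1 + height 2) ≡⟨ sym (+-assoc (height 0) _ _) ⟩
    low + height 2                   ≡⟨ heights-sum ⟩
    n                                ∎
    where open ≤-Reasoning

  height₁+3≤n : height 1 + 3 ≤ n
  height₁+3≤n = begin
    height 1 + 3        ≤⟨ +-monoʳ-≤ (height 1) (height≥3 0) ⟩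
    height 1 + height 0 ≡⟨ +-comm (height 1) (height 0) ⟩
    low                 ≤⟨ m≤m+n low (height 2) ⟩
    low + height 2      ≡⟨ heights-sum ⟩
    n                   ∎
    where open ≤-Reasoning

  1+[low∸1] : suc (low ∸ 1) ≡ low
  1+[low∸1] = m+[n∸m]≡n (≤-trans (s≤s z≤n) 6≤low)

  3≤low∸1 : 3 ≤ low ∸ 1
  3≤low∸1 = ∸-monoˡ-≤ 1 (≤-trans (s≤s (s≤s (s≤s (s≤s z≤n)))) 6≤low)

  low∸1+3≤n : low ∸ 1 + 3 ≤ n
  low∸1+3≤n = begin
    low ∸ 1 + 3       ≡⟨ +-suc (low ∸ 1) 2 ⟩
    suc (low ∸ 1) + 2 ≡⟨ cong (_+ 2) 1+[low∸1] ⟩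
    low + 2           ≤⟨ +-monoʳ-≤ low (≤-trans (s≤s (s≤s z≤n)) (height≥3 2)) ⟩
    low + height 2    ≡⟨ heights-sum ⟩
    n                 ∎
    where open ≤-Reasoning

  low+3≤n : low + 3 ≤ n
  low+3≤n = ≤-trans (+-monoʳ-≤ low (height≥3 2)) (≤-reflexive heights-sum)

  -- Consecutive positions r, r+1 land far apart; from the last block the
  -- step wraps back to the first.
  layout-far-next : ∀ r → Far (layout r) (layout (suc r))
  layout-far-next r with toDigits r
  ... | digits q 0 _ rewrite layout-digits q 0 (s≤s z≤n) | layout-digits q 1 (s≤s (s≤s z≤n)) =
    height 0 , height≥3 0 , height₀+3≤n , inj₁ (cong (_+ height 0) (+-identityʳ q))
  ... | digits q 1 _ rewrite layout-digits q 1 (s≤s (s≤s z≤n)) | layout-digits q 2 (s≤s (s≤s (s≤s z≤n))) =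
    height 1 , height≥3 1 , height₁+3≤n , inj₁ (+-assoc q (height 0) (height 1))
  ... | digits q 2 _ rewrite layout-digits q 2 (s≤s (s≤s (s≤s z≤n))) | layout-digits (suc q) 0 (s≤s z≤n) =
    low ∸ 1 , 3≤low∸1 , low∸1+3≤n , inj₂ wrap
    where
    wrap : suc q + 0 + (low ∸ 1) ≡ q + low
    wrap = begin
      suc q + 0 + (low ∸ 1) ≡⟨ cong (_+ (low ∸ 1)) (+-identityʳ (suc q)) ⟩
      suc (q + (low ∸ 1))   ≡⟨ sym (+-suc q (low ∸ 1)) ⟩
      q + suc (low ∸ 1)     ≡⟨ cong (q +_) 1+[low∸1] ⟩
      q + low               ∎
      where open ≡-Reasoning
  ... | digits q (suc (suc (suc _))) (s≤s (s≤s (s≤s ())))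

  layout-far-skip : ∀ r → 3 ∣ r → Far (layout r) (layout (2 + r))
  layout-far-skip .(q * 3) (divides-refl q)
    rewrite layout-digits q 0 (s≤s z≤n) | layout-digits q 2 (s≤s (s≤s (s≤s z≤n))) =
    low , ≤-trans (height≥3 0) (m≤m+n _ _) , low+3≤n , inj₁ (cong (_+ low) (+-identityʳ q))

module Ranking {n} (key : Fin n → ℕ) (key-injective : ∀ {u v} → key u ≡ key v → u ≡ v) where

  below : Fin n → Fin n → Bool
  below v x = does (key x <? key v)

  below-sound : ∀ {v x} → below v x ≡ true → key x < key v
  below-sound {v} {x} = does-sound (key x <? key v)

  below-complete : ∀ {v x} → key x < key v → below v x ≡ true
  below-complete {v} {x} = dec-true (key x <? key v)

  rank : Fin n → ℕ
  rank v = count (below v)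

  not-below-self : ∀ v → below v v ≡ false
  not-below-self v = dec-false (key v <? key v) (<-irrefl refl)

  rank<n : ∀ v → rank v < n
  rank<n v = count<n v (not-below-self v)

  rank-mono : ∀ {u v} → key u < key v → rank u < rank v
  rank-mono {u} {v} ku<kv =
    count-mono-< (λ x x<u → below-complete (<-trans (below-sound x<u) ku<kv))
                 u (not-below-self u) (below-complete ku<kv)

  rank-mono-≤ : ∀ {u v} → key u ≤ key v → rank u ≤ rank v
  rank-mono-≤ {u} {v} ku≤kv with m≤n⇒m<n∨m≡n ku≤kv
  ... | inj₁ ku<kv = <⇒≤ (rank-mono ku<kv)
  ... | inj₂ ku≡kv = ≤-reflexive (cong rank (key-injective ku≡kv))

  rank-reflects : ∀ {u v} → rank u < rank v → key u < key v
  rank-reflects {u} {v} ru<rv with <-cmp (key u) (key v)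
  ... | tri< ku<kv _ _ = ku<kv
  ... | tri≈ _ ku≡kv _ = ⊥-elim (<-irrefl (cong rank (key-injective ku≡kv)) ru<rv)
  ... | tri> _ _ kv<ku = ⊥-elim (<-asym ru<rv (rank-mono kv<ku))

  rank-injective : ∀ {u v} → rank u ≡ rank v → u ≡ v
  rank-injective {u} {v} e with <-cmp (key u) (key v)
  ... | tri< ku<kv _ _ = ⊥-elim (<-irrefl e (rank-mono ku<kv))
  ... | tri≈ _ ku≡kv _ = key-injective ku≡kv
  ... | tri> _ _ kv<ku = ⊥-elim (<-irrefl (sym e) (rank-mono kv<ku))

injective⇒onto : ∀ {n} (h : Fin n → Fin n) → Injective _≡_ _≡_ h → ∀ y → ∃ λ x → h x ≡ y
injective⇒onto {suc m} h h-injective y with any? (λ x → h x ≟ᶠ y)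
... | yes hit  = hit
... | no  miss = ⊥-elim (1+n≰n (injective⇒≤ squeezed-injective))
  where
  -- h misses y, so it factors injectively through a set with one point fewer
  y≢h : ∀ x → y ≢ h x
  y≢h x y≡hx = miss (x , sym y≡hx)
  squeezed : Fin (suc m) → Fin m
  squeezed x = punchOut (y≢h x)
  squeezed-injective : Injective _≡_ _≡_ squeezed
  squeezed-injective e = h-injective (punchOut-injective (y≢h _) (y≢h _) e)

inverting-permutation : ∀ {n} (h : Fin n → Fin n) → Injective _≡_ _≡_ h →
                        Σ (Permutation′ n) λ σ → ∀ i → h (σ ⟨$⟩ʳ i) ≡ i
inverting-permutation h h-injective =
  permutation h⁻¹ h (λ x → h-injective (h∘h⁻¹ (h x))) h∘h⁻¹ , h∘h⁻¹
  where
  h⁻¹ : Fin _ → Fin _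
  h⁻¹ y = proj₁ (injective⇒onto h h-injective y)
  h∘h⁻¹ : ∀ y → h (h⁻¹ y) ≡ y
  h∘h⁻¹ y = proj₂ (injective⇒onto h h-injective y)

-- The part of v: the vertices equal or non-adjacent to v.
part : ∀ {n} → Graph n → Fin n → Fin n → Bool
part G v x = not (adj G x v)

module Notation {n} (G : Graph n) where
  infix 4 _~_ _≁_
  _~_ _≁_ : Fin n → Fin n → Set
  u ~ v = adj G u v ≡ true
  u ≁ v = adj G u v ≡ false

  ~-sym : ∀ {u v} → u ~ v → v ~ u
  ~-sym {u} {v} u~v = trans (Graph.sym G v u) u~v

  ≁-sym : ∀ {u v} → u ≁ v → v ≁ u
  ≁-sym {u} {v} u≁v = trans (Graph.sym G v u) u≁v

  ≁-refl : ∀ v → v ≁ v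
  ≁-refl v = irrefl G v

  ~⇒≢ : ∀ {u v} → u ~ v → u ≢ v
  ~⇒≢ {u} u~v refl = case trans (sym u~v) (irrefl G u) of λ ()

  part-sound : ∀ {v x} → part G v x ≡ true → x ≁ v
  part-sound {v} {x} e with adj G x v
  ... | false = refl

  part-complete : ∀ {v x} → x ≁ v → part G v x ≡ true
  part-complete x≁v = cong not x≁v

-- G is complete multipartite: "equal or non-adjacent" is transitive, so the
-- parts are the classes of an equivalence relation.
CompleteMultipartite : ∀ {n} → Graph n → Set
CompleteMultipartite {n} G =
  ∀ {a b c : Fin n} → adj G a b ≡ false → adj G b c ≡ false → adj G a c ≡ false

module Multipartite {n} (G : Graph n) (≁-trans : CompleteMultipartite G) where

  open Notation G

  part-cong : ∀ {u v} → u ≁ v → ∀ x → part G u x ≡ part G v x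
  part-cong {u} {v} u≁v x with adj G x u in xu | adj G x v in xv
  ... | false | false = refl
  ... | true  | true  = refl
  ... | false | true  with () ← trans (sym xv) (≁-trans xu u≁v)
  ... | true  | false with () ← trans (sym xu) (≁-trans xv (≁-sym u≁v))

  union-of-triples : ∀ k (S : Fin n → Bool) → count S ≤ k →
                     (∀ {x y} → S x ≡ true → y ≁ x → S y ≡ true) →
                     (∀ {x} → S x ≡ true → count (part G x) ≡ 3) → 3 ∣ count S
  union-of-triples k S size closed triple with count S in |S|
  ... | zero = divides-refl 0
  union-of-triples (suc k) S size closed triple | suc m
    with x , Sˣ ← witness S (subst (0 <_) (sym |S|) (s≤s z≤n)) =
    subst (3 ∣_) (trans (sym split) |S|) (∣m∣n⇒∣m+n (∣-refl {3}) rest-divisible)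
    where
    rest : Fin n → Bool
    rest y = S y ∧ not (part G x y)
    part-in-S : count (λ y → S y ∧ part G x y) ≡ 3
    part-in-S = trans (count-cong in-S) (triple Sˣ)
      where
      in-S : ∀ y → (S y ∧ part G x y) ≡ part G x y
      in-S y with part G x y in e
      ... | false = ∧-zeroʳ (S y)
      ... | true rewrite closed Sˣ (part-sound e) = refl
    split : count S ≡ 3 + count rest
    split = trans (count-split S (part G x)) (cong (_+ count rest) part-in-S)
    rest-closed : ∀ {y z} → rest y ≡ true → z ≁ y → rest z ≡ true
    rest-closed {y} {z} e z≁y with S y in Sʸ | part G x y in pʸ | part G x z in pᶻ
    ... | true | false | false = cong₂ _∧_ (closed Sʸ z≁y) refl
    ... | true | false | true with () ←
      trans (sym pʸ) (part-complete (≁-trans (≁-sym z≁y) (part-sound pᶻ)))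
    rest-divisible : 3 ∣ count rest
    rest-divisible = union-of-triples k rest
      (≤-trans (m≤n+m (count rest) 2) (≤-pred (subst (_≤ suc k) (trans (sym |S|) split) size)))
      rest-closed (λ e → triple (Bool.∧-conicalˡ _ _ e))

  rep : Fin n → ℕ
  rep v = least (part G v)

  rep-cong : ∀ {u v} → u ≁ v → rep u ≡ rep v
  rep-cong u≁v = least-cong (part-cong u≁v)

  rep-≤ : ∀ {v x} → x ≁ v → rep v ≤ toℕ x
  rep-≤ x≁v = least-≤ _ (part-complete x≁v)

  rep<n : ∀ v → rep v < n
  rep<n v = ≤-<-trans (rep-≤ (≁-refl v)) (toℕ<n v)

  rep-sound : ∀ {u v} → rep u ≡ rep v → u ≁ v
  rep-sound {u} {v} e
    with y , yᵘ , ru≡y ← least-attained u (part-complete (≁-refl u))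
       | y′ , y′ᵛ , rv≡y′ ← least-attained v (part-complete (≁-refl v))
    with refl ← toℕ-injective (trans (sym ru≡y) (trans e rv≡y′))
    = ≁-trans (≁-sym (part-sound yᵘ)) (part-sound y′ᵛ)

  -- Parts of size 3 come first: their tier is 0, all others have tier 1.
  tier : Fin n → ℕ
  tier v = if does (count (part G v) ≟ 3) then 0 else 1

  tier-cong : ∀ {u v} → u ≁ v → tier u ≡ tier v
  tier-cong u≁v = cong (λ m → if does (m ≟ 3) then 0 else 1) (count-cong (part-cong u≁v))

  tier-0 : ∀ {v} → count (part G v) ≡ 3 → tier v ≡ 0
  tier-0 {v} e rewrite dec-true (count (part G v) ≟ 3) e = refl

  tier-0⁻ : ∀ {v} → tier v ≡ 0 → count (part G v) ≡ 3
  tier-0⁻ {v} e = does-sound (count (part G v) ≟ 3) (if-0 e)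
    where
    if-0 : ∀ {b} → (if b then 0 else 1) ≡ 0 → b ≡ true
    if-0 {true} _ = refl

  -- Parts are labelled by (tier, representative); vertices are keyed by
  -- (label, index), both lexicographically.
  label : Fin n → ℕ
  label v = rep v + tier v * n

  key : Fin n → ℕ
  key v = toℕ v + label v * n

  label-cong : ∀ {u v} → u ≁ v → label u ≡ label v
  label-cong u≁v = cong₂ (λ r t → r + t * n) (rep-cong u≁v) (tier-cong u≁v)

  label-sound : ∀ {u v} → label u ≡ label v → u ≁ v
  label-sound {u} {v} e = rep-sound (proj₂ (lex-≡ {tier u} {tier v} e (rep<n u) (rep<n v)))

  key-injective : ∀ {u v} → key u ≡ key v → u ≡ v
  key-injective {u} {v} e = toℕ-injective (proj₂ (lex-≡ {label u} {label v} e (toℕ<n u) (toℕ<n v)))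

  open Ranking key key-injective public

  key-convex : ∀ {u w x} → u ≁ w → key u ≤ key x → key x ≤ key w → x ≁ u
  key-convex {u} {w} {x} u≁w ku≤kx kx≤kw = label-sound (≤-antisym lx≤lu lu≤lx)
    where
    lu≤lx : label u ≤ label x
    lu≤lx = lex-≤ ku≤kx (toℕ<n x)
    lx≤lu : label x ≤ label u
    lx≤lu = ≤-trans (lex-≤ kx≤kw (toℕ<n w)) (≤-reflexive (sym (label-cong u≁w)))

  contiguity : ∀ {u w} → u ≁ w → key u < key w → rank w < rank u + count (part G u)
  contiguity {u} {w} u≁w ku<kw = begin-strict
    rank w                                            ≤⟨ count-mono below-w⇒ ⟩
    count (λ x → below u x ∨ (part G u ∖ w) x)        ≤⟨ count-∨ (below u) (part G u ∖ w) ⟩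
    rank u + count (part G u ∖ w)                     <⟨ +-monoʳ-< (rank u) (count-∖ w (part-complete (≁-sym u≁w))) ⟩
    rank u + count (part G u)                         ∎
    where
    open ≤-Reasoning
    below-w⇒ : ∀ x → below w x ≡ true → (below u x ∨ (part G u ∖ w) x) ≡ true
    below-w⇒ x x<w with below u x in x<u?
    ... | true  = refl
    ... | false = cong₂ _∧_ (part-complete (key-convex u≁w ku≤kx (<⇒≤ kx<kw)))
                            (cong not (==-false (λ x≡w → <-irrefl (cong key x≡w) kx<kw)))
      where
      kx<kw : key x < key w
      kx<kw = below-sound x<w
      ku≤kx : key u ≤ key x
      ku≤kx = ≮⇒≥ (λ kx<ku → case trans (sym (below-complete kx<ku)) x<u? of λ ())

  -- Alignment: the least vertex of a part of size 3 has rank divisible by 3,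
  -- since everything before it is a union of parts of size 3.
  alignment : ∀ {u} → count (part G u) ≡ 3 → rep u ≡ toℕ u → 3 ∣ rank u
  alignment {u} |u|≡3 u-least = union-of-triples n (below u) (count≤n _) closed triple
    where
    label-below : ∀ {x} → below u x ≡ true → label x ≤ label u
    label-below x<u = lex-≤ (<⇒≤ (below-sound x<u)) (toℕ<n u)
    triple : ∀ {x} → below u x ≡ true → count (part G x) ≡ 3
    triple {x} x<u = tier-0⁻ (n≤0⇒n≡0 (≤-trans (lex-≤ {tier x} {tier u} (label-below x<u) (rep<n u))
                                                 (≤-reflexive (tier-0 |u|≡3))))
    closed : ∀ {x y} → below u x ≡ true → y ≁ x → below u y ≡ true
    closed {x} {y} x<u y≁x = below-complete ky<ku
      where
      ky<ku : key y < key u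
      ky<ku with m≤n⇒m<n∨m≡n (label-below x<u)
      ... | inj₁ lx<lu = lex-< (subst (_< label u) (sym (label-cong y≁x)) lx<lu) (toℕ<n y)
      ... | inj₂ lx≡lu = ⊥-elim (<⇒≱ tx<tu tu≤tx)
        where
        tu≤tx : toℕ u ≤ toℕ x
        tu≤tx = subst (_≤ toℕ x) u-least (rep-≤ (label-sound lx≡lu))
        tx<tu : toℕ x < toℕ u
        tx<tu = +-cancelʳ-< (label u * n) (toℕ x) (toℕ u)
                  (subst (λ l → toℕ x + l * n < toℕ u + label u * n) lx≡lu (below-sound x<u))

  module _ (part≤3 : ∀ v → count (part G v) ≤ 3) where

    twin-ranks : ∀ {u w} → u ≁ w → rank u < rank w →
                 rank w ≡ suc (rank u) ⊎ (rank w ≡ 2 + rank u × 3 ∣ rank u)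
    twin-ranks {u} {w} u≁w ru<rw with rank w ≟ suc (rank u)
    ... | yes next = inj₁ next
    ... | no  skip =
      inj₂ (rw≡2+ru , subst (3 ∣_) (sym ru≡rr) (alignment |r|≡3 (trans (rep-cong r≁u) rep-u≡r)))
      where
      least-u : ∃ λ r → part G u r ≡ true × rep u ≡ toℕ r
      least-u = least-attained u (part-complete (≁-refl u))
      r : Fin n
      r = proj₁ least-u
      r≁u : r ≁ u
      r≁u = part-sound (proj₁ (proj₂ least-u))
      rep-u≡r : rep u ≡ toℕ r
      rep-u≡r = proj₂ (proj₂ least-u)
      kr≤ku : key r ≤ key u
      kr≤ku = +-mono-≤ (subst (_≤ toℕ u) rep-u≡r (rep-≤ (≁-refl u)))
                        (≤-reflexive (cong (_* n) (label-cong r≁u)))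
      tight : rank u ≡ rank r × rank w ≡ 2 + rank u × count (part G r) ≡ 3
      tight = squeeze (rank-mono-≤ kr≤ku) ru<rw
                (contiguity (≁-trans r≁u u≁w) (≤-<-trans kr≤ku (rank-reflects ru<rw))) (part≤3 r) skip
      ru≡rr : rank u ≡ rank r
      ru≡rr = proj₁ tight
      rw≡2+ru : rank w ≡ 2 + rank u
      rw≡2+ru = proj₁ (proj₂ tight)
      |r|≡3 : count (part G r) ≡ 3
      |r|≡3 = proj₂ (proj₂ tight)

    module _ (9≤n : 9 ≤ n) where
      open Cycle n
      open Layout n 9≤n

      ordered-far : ∀ {u w} → u ≁ w → rank u < rank w → Far (layout (rank u)) (layout (rank w))
      ordered-far {u} u≁w ru<rw with twin-ranks u≁w ru<rw
      ... | inj₁ next rewrite next = layout-far-next (rank u)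
      ... | inj₂ (skip , 3∣ru) rewrite skip = layout-far-skip (rank u) 3∣ru

      position : Fin n → Fin n
      position v = fromℕ< (layout<n (rank<n v))

      toℕ-position : ∀ v → toℕ (position v) ≡ layout (rank v)
      toℕ-position v = toℕ-fromℕ< (layout<n (rank<n v))

      position-injective : Injective _≡_ _≡_ position
      position-injective {u} {v} e = rank-injective (layout-injective (rank<n u) (rank<n v)
        (trans (sym (toℕ-position u)) (trans (cong toℕ e) (toℕ-position v))))

      part-far : ∀ {u w} → u ≁ w → u ≢ w → Far (toℕ (position u)) (toℕ (position w))
      part-far {u} {w} u≁w u≢w rewrite toℕ-position u | toℕ-position w with <-cmp (rank u) (rank w)
      ... | tri< ru<rw _ _ = ordered-far u≁w ru<rw
      ... | tri≈ _ ru≡rw _ = ⊥-elim (u≢w (rank-injective ru≡rw))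
      ... | tri> _ _ rw<ru = Far-sym (ordered-far (≁-sym u≁w) rw<ru)

      cycle : Permutation′ n
      cycle = proj₁ (inverting-permutation position position-injective)

      position-cycle : ∀ i → position (cycle ⟨$⟩ʳ i) ≡ i
      position-cycle = proj₂ (inverting-permutation position position-injective)

      placed-adjacent : ∀ {d u w} → 0 < d → d ≤ 2 → Step d (toℕ (position u)) (toℕ (position w)) →
                        adj G u w ≡ true
      placed-adjacent {d} {u} {w} 0<d d≤2 u⇝w = Bool.¬-not λ u≁w → far⇒¬step (part-far u≁w u≢w) d≤2 u⇝w
        where
        u≢w : u ≢ w
        u≢w refl = step-irrefl 0<d (≤-<-trans d≤2 (≤-trans (s≤s (s≤s (s≤s z≤n))) 9≤n)) u⇝w

      square-edge : ∀ d i j → 0 < d → d ≤ 2 → Step d (toℕ i) (toℕ j) →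
                    adj G (cycle ⟨$⟩ʳ i) (cycle ⟨$⟩ʳ j) ≡ true
      square-edge d i j 0<d d≤2 i⇝j = placed-adjacent 0<d d≤2
        (subst₂ (λ a b → Step d (toℕ a) (toℕ b)) (sym (position-cycle i)) (sym (position-cycle j)) i⇝j)

multipartite-H² : ∀ {n} (G : Graph n) → CompleteMultipartite G →
                  (∀ v → count (part G v) ≤ 3) → 9 ≤ n → ContainsH² G
multipartite-H² G ≁-trans part≤3 9≤n = cycle part≤3 9≤n , λ
  { i j (inj₁ one-step)  → square-edge part≤3 9≤n 1 i j (s≤s z≤n) (s≤s z≤n) one-step
  ; i j (inj₂ two-steps) → square-edge part≤3 9≤n 2 i j (s≤s z≤n) (s≤s (s≤s z≤n)) two-steps }
  where open Multipartite G ≁-trans using (cycle; square-edge)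

-- To exhibit an induced copy it suffices to preserve adjacency and to keep
-- non-adjacent vertices of H apart; adjacent ones stay apart by irreflexivity.
induced-copy : ∀ {k n} {H : Graph k} {G : Graph n} (f : Fin k → Fin n) →
               (∀ i j → adj G (f i) (f j) ≡ adj H i j) →
               (∀ i j → i ≢ j → adj H i j ≡ false → f i ≢ f j) → InducedCopy H G
induced-copy {H = H} {G} f preserve apart = record { f = f ; inj = f-injective ; preserve = preserve }
  where
  open Notation G
  f-injective : Injective _≡_ _≡_ f
  f-injective {i} {j} fi≡fj with i ≟ᶠ j | adj H i j in ij
  ... | yes i≡j | _     = i≡j
  ... | no  i≢j | false = ⊥-elim (apart i j i≢j ij fi≡fj)
  ... | no  i≢j | true  = ⊥-elim (~⇒≢ (trans (preserve i j) ij) fi≡fj)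

module _ {n} {G : Graph n} where
  open Notation G

  Z₁-witness : ∀ {c a b d} → c ~ a → c ~ b → c ~ d → a ~ b → a ≁ d → b ≁ d → InducedCopy Z₁ G
  Z₁-witness {c} {a} {b} {d} c~a c~b c~d a~b a≁d b≁d = induced-copy f preserve apart
    where
    f : Fin 4 → Fin n
    f zero                   = c
    f (suc zero)             = a
    f (suc (suc zero))       = b
    f (suc (suc (suc zero))) = d
    preserve : ∀ i j → adj G (f i) (f j) ≡ adj Z₁ i j
    preserve zero                   zero                   = irrefl G c
    preserve zero                   (suc zero)             = c~a
    preserve zero                   (suc (suc zero))       = c~b
    preserve zero                   (suc (suc (suc zero))) = c~d
    preserve (suc zero)             zero                   = ~-sym c~a
    preserve (suc zero)             (suc zero)             = irrefl G a
    preserve (suc zero)             (suc (suc zero))       = a~b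
    preserve (suc zero)             (suc (suc (suc zero))) = a≁d
    preserve (suc (suc zero))       zero                   = ~-sym c~b
    preserve (suc (suc zero))       (suc zero)             = ~-sym a~b
    preserve (suc (suc zero))       (suc (suc zero))       = irrefl G b
    preserve (suc (suc zero))       (suc (suc (suc zero))) = b≁d
    preserve (suc (suc (suc zero))) zero                   = ~-sym c~d
    preserve (suc (suc (suc zero))) (suc zero)             = ≁-sym a≁d
    preserve (suc (suc (suc zero))) (suc (suc zero))       = ≁-sym b≁d
    preserve (suc (suc (suc zero))) (suc (suc (suc zero))) = irrefl G d
    a≢d : a ≢ d
    a≢d refl = case trans (sym (~-sym a~b)) b≁d of λ ()
    b≢d : b ≢ d
    b≢d refl = case trans (sym a~b) a≁d of λ ()
    apart : ∀ i j → i ≢ j → adj Z₁ i j ≡ false → f i ≢ f j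
    apart (suc zero)             (suc (suc (suc zero))) _ _ = a≢d
    apart (suc (suc (suc zero))) (suc zero)             _ _ = a≢d ∘ sym
    apart (suc (suc zero))       (suc (suc (suc zero))) _ _ = b≢d
    apart (suc (suc (suc zero))) (suc (suc zero))       _ _ = b≢d ∘ sym
    apart zero                   zero                   i≢i _ = ⊥-elim (i≢i refl)
    apart (suc zero)             (suc zero)             i≢i _ = ⊥-elim (i≢i refl)
    apart (suc (suc zero))       (suc (suc zero))       i≢i _ = ⊥-elim (i≢i refl)
    apart (suc (suc (suc zero))) (suc (suc (suc zero))) i≢i _ = ⊥-elim (i≢i refl)
    apart zero                   (suc zero)             _ ()
    apart zero                   (suc (suc zero))       _ ()
    apart zero                   (suc (suc (suc zero))) _ ()
    apart (suc zero)             zero                   _ ()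
    apart (suc zero)             (suc (suc zero))       _ ()
    apart (suc (suc zero))       zero                   _ ()
    apart (suc (suc zero))       (suc zero)             _ ()
    apart (suc (suc (suc zero))) zero                   _ ()

  K₁₄-witness : ∀ c (ℓ : Fin 4 → Fin n) → Injective _≡_ _≡_ ℓ →
                (∀ i → c ~ ℓ i) → (∀ i j → ℓ i ≁ ℓ j) → InducedCopy K₁₄ G
  K₁₄-witness c ℓ ℓ-injective hub independent = induced-copy f preserve apart
    where
    f : Fin 5 → Fin n
    f zero    = c
    f (suc i) = ℓ i
    preserve : ∀ i j → adj G (f i) (f j) ≡ adj K₁₄ i j
    preserve zero    zero    = irrefl G c
    preserve zero    (suc j) = hub j
    preserve (suc i) zero    = ~-sym (hub i)
    preserve (suc i) (suc j) = independent i j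
    apart : ∀ i j → i ≢ j → adj K₁₄ i j ≡ false → f i ≢ f j
    apart zero    zero    i≢i _ = ⊥-elim (i≢i refl)
    apart (suc i) (suc j) i≢j _ = i≢j ∘ cong suc ∘ ℓ-injective
    apart zero    (suc _) _ ()
    apart (suc _) zero    _ ()

  independent≤3 : Free K₁₄ G → ∀ c (I : Fin n → Bool) → (∀ {x} → I x ≡ true → c ~ x) →
                  (∀ {x y} → I x ≡ true → I y ≡ true → x ≁ y) → count I ≤ 3
  independent≤3 K₁₄-free c I hub independent with 4 ≤? count I
  ... | no  4≰|I| = ≤-pred (≰⇒> 4≰|I|)
  ... | yes 4≤|I| = ⊥-elim (K₁₄-free (claw (distinct I 4 4≤|I|)))
    where
    claw : (Σ (Fin 4 → Fin n) λ ℓ → Injective _≡_ _≡_ ℓ × (∀ i → I (ℓ i) ≡ true)) → InducedCopy K₁₄ G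
    claw (ℓ , ℓ-injective , ℓ∈I) =
      K₁₄-witness c ℓ ℓ-injective (hub ∘ ℓ∈I) (λ i j → independent (ℓ∈I i) (ℓ∈I j))

∣tabulate∣ : ∀ {n} (p : Fin n → Bool) → ∣ tabulate p ∣ ≡ count p
∣tabulate∣ {zero}  p = refl
∣tabulate∣ {suc n} p with p zero
... | true  = cong suc (∣tabulate∣ (p ∘ suc))
... | false = ∣tabulate∣ (p ∘ suc)

∈tabulate : ∀ {n} {p : Fin n → Bool} {x} → p x ≡ true → x ∈ tabulate p
∈tabulate {p = p} {x} pˣ = lookup⇒[]= x (tabulate p) (trans (lookup∘tabulate p x) pˣ)

∉tabulate⁻ : ∀ {n} {p : Fin n → Bool} {x} → p x ≡ false → x ∉ tabulate p
∉tabulate⁻ {p = p} {x} pˣ x∈ =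
  case trans (sym (trans (sym (lookup∘tabulate p x)) ([]=⇒lookup x∈))) pˣ of λ ()

walk-start : ∀ {n} {G : Graph n} {S u v} → ReachAvoiding G S u v → u ∉ S
walk-start (here u∉S)     = u∉S
walk-start (step u∉S _ _) = u∉S

module _ {k n} {G : Graph n} (G-connected : KConnected k G) where
  open Notation G

  -- In a k-connected graph every vertex has at least k neighbours: otherwise
  -- deleting its neighbourhood would isolate it from some other vertex.
  min-degree : ∀ u → k ≤ count (adj G u)
  min-degree u with k ≤? count (adj G u)
  ... | yes k≤deg = k≤deg
  ... | no  k≰deg = ⊥-elim (isolated y≢u (proj₂ G-connected N |N|<k u y u∉N y∉N))
    where
    N : Subset n
    N = tabulate (adj G u)
    |N|<k : ∣ N ∣ < k
    |N|<k = subst (_< k) (sym (∣tabulate∣ (adj G u))) (≰⇒> k≰deg)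
    others : count (λ y → adj G u y ∨ y == u) < n
    others = begin-strict
      count (λ y → adj G u y ∨ y == u)  ≤⟨ count-∨ (adj G u) (_== u) ⟩
      count (adj G u) + count (_== u)   ≡⟨ cong (count (adj G u) +_) (count-single u) ⟩
      count (adj G u) + 1               ≡⟨ +-comm (count (adj G u)) 1 ⟩
      suc (count (adj G u))             ≤⟨ ≰⇒> k≰deg ⟩
      k                                 <⟨ proj₁ G-connected ⟩
      n                                 ∎
      where open ≤-Reasoning
    y : Fin n
    y = proj₁ (counter-witness _ others)
    y-outside : (adj G u y ∨ y == u) ≡ false
    y-outside = proj₂ (counter-witness _ others)
    y∉N : y ∉ N
    y∉N = ∉tabulate⁻ (Bool.∨-conicalˡ _ _ y-outside)
    y≢u : y ≢ u
    y≢u = ==-false⁻ (Bool.∨-conicalʳ _ _ y-outside)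
    u∉N : u ∉ N
    u∉N = ∉tabulate⁻ (irrefl G u)
    isolated : ∀ {z} → z ≢ u → ReachAvoiding G N u z → ⊥
    isolated z≢u (here _)           = z≢u refl
    isolated z≢u (step _ u~v v⇝z) = walk-start v⇝z (∈tabulate u~v)

  connected : 0 < k → ∀ u v → ReachAvoiding G ∅ u v
  connected 0<k u v = proj₂ G-connected ∅ (subst (_< k) (sym (∣∅∣≡0 n)) 0<k) u v ∉∅ ∉∅

module FourConnected {n} (G : Graph n) (G-connected : KConnected 4 G)
                     (Z₁-free : Free Z₁ G) (K₁₄-free : Free K₁₄ G) where
  open Notation G

  no-Z₁ : ∀ {c a b d} → c ~ a → c ~ b → c ~ d → a ~ b → a ≁ d → b ≁ d → ⊥
  no-Z₁ c~a c~b c~d a~b a≁d b≁d = Z₁-free (Z₁-witness c~a c~b c~d a~b a≁d b≁d)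

  -- Otherwise every neighbour of u misses x and w (else Z₁ at u),
  -- so the neighbourhood of u is independent (else Z₁ at u), contradicting
  -- minimum degree 4 in a K₁₄-free graph.
  common-neighbour : ∀ {u x w} → u ~ x → u ~ w → x ≁ w → ∃ λ t → u ~ t × t ~ x × t ~ w
  common-neighbour {u} {x} {w} u~x u~w x≁w
    with any? (λ t → (adj G u t Bool.≟ true) ×-dec (adj G t x Bool.≟ true) ×-dec (adj G t w Bool.≟ true))
  ... | yes found = found
  ... | no  none  = ⊥-elim (<⇒≱ (min-degree G-connected u)
                      (independent≤3 K₁₄-free u (adj G u) (λ u~t → u~t) independent))
    where
    misses : ∀ {t} → u ~ t → t ≁ x × t ≁ w
    misses {t} u~t with adj G t x in t-x | adj G t w in t-w
    ... | true  | true  = ⊥-elim (none (t , u~t , t-x , t-w))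
    ... | true  | false = ⊥-elim (no-Z₁ u~t u~x u~w t-x t-w x≁w)
    ... | false | true  = ⊥-elim (no-Z₁ u~t u~w u~x t-w t-x (≁-sym x≁w))
    ... | false | false = refl , refl
    independent : ∀ {s t} → u ~ s → u ~ t → s ≁ t
    independent {s} {t} u~s u~t with adj G s t in s-t
    ... | false = refl
    ... | true  = ⊥-elim (no-Z₁ u~s u~t u~x s-t (proj₁ (misses u~s)) (proj₁ (misses u~t)))

  -- A neighbour x of a vertex z that misses both ends of an edge u w cannot
  -- see exactly one end: a common neighbour t of u, x, w gives a Z₁ either way.
  one-sided : ∀ {u w z x} → u ~ w → z ≁ u → z ≁ w → z ~ x → x ~ u → x ≁ w → ⊥
  one-sided {z = z} u~w z≁u z≁w z~x x~u x≁w with common-neighbour (~-sym x~u) u~w x≁w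
  ... | t , u~t , t~x , t~w with adj G t z in t-z
  ... | false = no-Z₁ x~u (~-sym t~x) (~-sym z~x) u~t (≁-sym z≁u) t-z
  ... | true  = no-Z₁ (~-sym u~t) t~w t-z u~w (≁-sym z≁u) (≁-sym z≁w)

  module _ {u w} (u~w : u ~ w) where
    Missing : Fin n → Set
    Missing z = z ≁ u × z ≁ w

    missing-step : ∀ {z x} → Missing z → z ~ x → Missing x
    missing-step {z} {x} (z≁u , z≁w) z~x with adj G x u in x-u | adj G x w in x-w
    ... | true  | true  = ⊥-elim (no-Z₁ x-u x-w (~-sym z~x) u~w (≁-sym z≁u) (≁-sym z≁w))
    ... | true  | false = ⊥-elim (one-sided u~w z≁u z≁w z~x x-u x-w)
    ... | false | true  = ⊥-elim (one-sided (~-sym u~w) z≁w z≁u z~x x-w x-u)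
    ... | false | false = refl , refl

    missing-walk : ∀ {S z y} → ReachAvoiding G S z y → Missing z → Missing y
    missing-walk (here _)         m = m
    missing-walk (step _ z~x x⇝y) m = missing-walk x⇝y (missing-step m z~x)

  -- As G is connected, no vertex misses both ends of an edge: non-adjacency
  -- is transitive.
  ≁-transitive : CompleteMultipartite G
  ≁-transitive {a} {b} {c} a≁b b≁c with adj G a c in a-c
  ... | false = refl
  ... | true  = case trans (sym a-c) (proj₂ (missing-walk a-c b⇝a (≁-sym a≁b , b≁c))) of λ ()
    where
    b⇝a : ReachAvoiding G ∅ b a
    b⇝a = connected G-connected (s≤s z≤n) b a

  -- Every part is an independent set inside the neighbourhood of any
  -- neighbour of it, hence has at most three vertices.
  part≤3 : ∀ v → count (part G v) ≤ 3
  part≤3 v with t , v~t ← witness (adj G v) (≤-trans (s≤s z≤n) (min-degree G-connected v)) =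
    independent≤3 K₁₄-free t (part G v) t~part independent
    where
    t~part : ∀ {x} → part G v x ≡ true → t ~ x
    t~part {x} x∈v with adj G t x in t-x | adj G x v in x-v
    ... | true  | _     = refl
    ... | false | false = case trans (sym (~-sym v~t)) (≁-transitive t-x x-v) of λ ()
    independent : ∀ {x y} → part G v x ≡ true → part G v y ≡ true → x ≁ y
    independent x∈v y∈v = ≁-transitive (part-sound x∈v) (≁-sym (part-sound y∈v))

theorem5 : ∀ (n : ℕ) (G : Graph n) → KConnected 4 G → Free Z₁ G → Free K₁₄ G →
    9 ≤ n → ContainsH² G
theorem5 n G G-connected Z₁-free K₁₄-free 9≤n =
  multipartite-H² G ≁-transitive part≤3 9≤n
  where open FourConnected G G-connected Z₁-free K₁₄-free
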